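{- The relation $<$ on $\mathrm{MutualOrd}$ is trichotomous in the sense that for all $a, b : \mathrm{MutualOrd}$ there is an element of $(a < b) \uplus (a \geq b)$.
   Context: Work in cubical type theory (as implemented in cubical Agda); $x \equiv y$ denotes the path type, $A \uplus B$ the coproduct. $\mathrm{MutualOrd} : \mathrm{Type}_0$ is defined simultaneously (inductive-inductive-recursively) with a relation $<$ on it and a function $\mathrm{fst} : \mathrm{MutualOrd} \to \mathrm{MutualOrd}$: its constructors are $\mathbf{0}$ and, for $a, b : \mathrm{MutualOrd}$ and $r : a \geq \mathrm{fst}(b)$, an element $\omega^a + b\,[r]$, where $a \geq b := (b < a) \uplus (a \equiv b)$. The relation $<$ is generated by: $\mathbf{0} < \omega^a + b\,[r]$; if $a < c$ then $\omega^a + b\,[r] < \omega^c + d\,[s]$; if $a \equiv c$ and $b < d$ then $\omega^a + b\,[r] < \omega^c + d\,[s]$. Finally $\mathrm{fst}(\mathbf{0}) = \mathbf{0}$ and $\mathrm{fst}(\omega^a + b\,[r]) = a$. -}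

module Defs where

open import Data.Sum using (_⊎_)
open import Relation.Binary.PropositionalEquality using (_≡_)

-- Inductive-inductive-recursive definition of MutualOrd (ordinals below ε₀
-- in Cantor normal form), following the paper.

data MutualOrd : Set
data _<_ : MutualOrd → MutualOrd → Set
fst : MutualOrd → MutualOrd

_≥_ : MutualOrd → MutualOrd → Set
a ≥ b = (b < a) ⊎ (a ≡ b)

infix 30 _<_ _≥_

data MutualOrd where
  𝟎 : MutualOrd
  ω^_+_[_] : (a b : MutualOrd) → a ≥ fst b → MutualOrd

data _<_ where
  <₁ : ∀ {a b r} → 𝟎 < ω^ a + b [ r ]
  <₂ : ∀ {a b c d r s} → a < c → ω^ a + b [ r ] < ω^ c + d [ s ]
  <₃ : ∀ {a b c d r s} → a ≡ c → b < d → ω^ a + b [ r ] < ω^ c + d [ s ]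

fst 𝟎 = 𝟎
fst ω^ a + b [ r ] = a

module Submission where

-- Comparing ω^a + b [r] with ω^c + d [s] is lexicographic: first compare the
-- leading exponents a, c, and only if they are equal compare the tails b, d.
-- By induction on both arguments this decides a < b or a ≥ b, except for one
-- subtle point: when a ≡ c and b ≡ d we must conclude that the two terms are
-- EQUAL, although they carry possibly different proofs r, s of the side
-- condition a ≥ fst b.  So we first show that _<_ is irreflexive, hence that
-- _<_ and _≥_ are proposition-valued (a < b is never also b ≡ a), which makes
-- the side condition irrelevant and yields the congruence lemma ω^-cong.

open import Defs
open import Data.Sum using (_⊎_; inj₁; inj₂)
open import Data.Empty using (⊥; ⊥-elim)
open import Relation.Binary.PropositionalEquality using (_≡_; refl; sym; cong)
open import Relation.Nullary using (¬_)
open import Axiom.UniquenessOfIdentityProofs.WithK using (uip)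

<-irrefl : ∀ {a} → ¬ (a < a)
<-irrefl (<₂ a<a) = <-irrefl a<a
<-irrefl (<₃ _ b<b) = <-irrefl b<b

-- Proofs of a < b are unique: the two step rules <₂ and <₃ cannot both
-- apply, since <₃ forces equal exponents and <₂ would then be irreflexive.
<-irrelevant : ∀ {a b} (p q : a < b) → p ≡ q
<-irrelevant <₁ <₁ = refl
<-irrelevant (<₂ p) (<₂ q) = cong <₂ (<-irrelevant p q)
<-irrelevant (<₂ p) (<₃ refl _) = ⊥-elim (<-irrefl p)
<-irrelevant (<₃ refl _) (<₂ q) = ⊥-elim (<-irrefl q)
<-irrelevant (<₃ refl p) (<₃ refl q) = cong (<₃ refl) (<-irrelevant p q)

-- Proofs of a ≥ b are unique: the two disjuncts b < a and a ≡ b exclude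
-- each other by irreflexivity, and each is itself a proposition.
≥-irrelevant : ∀ {a b} (p q : a ≥ b) → p ≡ q
≥-irrelevant (inj₁ p) (inj₁ q) = cong inj₁ (<-irrelevant p q)
≥-irrelevant (inj₁ p) (inj₂ refl) = ⊥-elim (<-irrefl p)
≥-irrelevant (inj₂ refl) (inj₁ q) = ⊥-elim (<-irrefl q)
≥-irrelevant (inj₂ p) (inj₂ q) = cong inj₂ (uip p q)

ω^-cong : ∀ {a b c d r s} → a ≡ c → b ≡ d → ω^ a + b [ r ] ≡ ω^ c + d [ s ]
ω^-cong {r = r} {s} refl refl = cong ω^ _ + _ [_] (≥-irrelevant r s)

mainTheorem11 : (a b : MutualOrd) → (a < b) ⊎ (a ≥ b)
mainTheorem11 𝟎 𝟎 = inj₂ (inj₂ refl)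
mainTheorem11 𝟎 ω^ _ + _ [ _ ] = inj₁ <₁
mainTheorem11 ω^ _ + _ [ _ ] 𝟎 = inj₂ (inj₁ <₁)
mainTheorem11 ω^ a + b [ _ ] ω^ c + d [ _ ] with mainTheorem11 a c
... | inj₁ a<c = inj₁ (<₂ a<c)
... | inj₂ (inj₁ c<a) = inj₂ (inj₁ (<₂ c<a))
... | inj₂ (inj₂ a≡c) with mainTheorem11 b d
...   | inj₁ b<d = inj₁ (<₃ a≡c b<d)
...   | inj₂ (inj₁ d<b) = inj₂ (inj₁ (<₃ (sym a≡c) d<b))
...   | inj₂ (inj₂ b≡d) = inj₂ (inj₂ (ω^-cong a≡c b≡d))
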